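{- Let $G=(V,E)$ be a graph with $|V|=n$ in which all vertices have degree $\sim d$. Then for any fixed number of colors $r\ge 2$, \[ \kappa_{r,2}(G)\le\left(1-\frac1r+o(1)\right)\frac{d^2}{n}. \]
   Context: Here $G=G_n$ is a sequence of graphs and $d=d(n)$; asymptotics are as $n\to\infty$ and $f\sim g$ means $f=(1+o(1))g$. A path is alternating (with respect to an edge-coloring) if no two consecutive edges have the same color; the length of a path is its number of edges. $\kappa_{r,\ell}(G)$ is the maximum $t$ such that there is an $r$-edge-coloring of $G$ in which every pair of distinct vertices is connected by $t$ internally vertex-disjoint alternating paths of length $\ell$. -}

module Defs where

open import Data.Nat using (ℕ; _+_)
open import Data.Bool using (Bool; true; false; if_then_else_)
open import Data.Fin using (Fin)
open import Data.List using (map; allFin)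
open import Data.Nat.ListAction using (sum)
open import Data.Product using (Σ; _×_; _,_)
open import Relation.Binary.PropositionalEquality using (_≡_; _≢_)
open import Function.Definitions using (Injective)

record Graph (n : ℕ) : Set where
  field
    adj    : Fin n → Fin n → Bool
    sym    : ∀ u v → adj u v ≡ adj v u
    irrefl : ∀ v → adj v v ≡ false
open Graph public

deg : ∀ {n} → Graph n → Fin n → ℕ
deg G v = sum (map (λ w → if adj G v w then 1 else 0) (allFin _))

-- An r-edge-colouring: a colour c u v for every ordered pair, which is
-- symmetric on edges (only values on edges matter).
EdgeColouring : ∀ {n} → Graph n → ℕ → Set
EdgeColouring {n} G r =
  Σ (Fin n → Fin n → Fin r) λ c → ∀ u v → adj G u v ≡ true → c u v ≡ c v u

-- u - w - v is an alternating path of length 2 (w ≠ u, v automatically,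
-- since the graph is loopless).
AltPath2 : ∀ {n r} (G : Graph n) → EdgeColouring G r → Fin n → Fin n → Fin n → Set
AltPath2 G (c , _) u w v = adj G u w ≡ true × adj G w v ≡ true × c u w ≢ c w v

-- u and v are joined by t internally vertex-disjoint alternating paths of
-- length 2: i.e. t pairwise distinct middle vertices.
DisjAltPaths2 : ∀ {n r} (G : Graph n) → EdgeColouring G r → Fin n → Fin n → ℕ → Set
DisjAltPaths2 {n} G col u v t =
  Σ (Fin t → Fin n) λ mid → Injective _≡_ _≡_ mid × (∀ i → AltPath2 G col u (mid i) v)

-- t is achievable for κ_{r,2}(G): some r-edge-colouring in which every pair
-- of distinct vertices is joined by t internally disjoint alternating
-- paths of length 2.  κ_{r,2}(G) is the maximum achievable t.
Achievable2 : ∀ {n} → ℕ → Graph n → ℕ → Set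
Achievable2 {n} r G t =
  Σ (EdgeColouring G r) λ col → ∀ (u v : Fin n) → u ≢ v → DisjAltPaths2 G col u v t

-- Fix a colouring and a middle vertex w.  A path u – w – v alternates exactly when the
-- edges uw and vw have different colours, so the ordered pairs (u, v) served by w are the
-- bichromatic pairs of the r colour classes of the neighbourhood of w.  By Cauchy–Schwarz
-- at least deg(w)²/r of the deg(w)² pairs are monochromatic.  Every ordered pair of
-- distinct vertices needs t distinct middle vertices, so summing over w gives
--   t·n(n − 1) ≤ (1 − 1/r) Σ_w deg(w)² ≤ (1 − 1/r) n ((1 + δ) d)².
-- With δ = 1/M, M = 4k, 1/k ≤ ε and n > M, both (1 + δ)² and n/(n − 1) fit into the ε.

module Submission where

module Counting where

  open import Defs renaming (sym to adj-sym)
  open import Data.Nat using (ℕ; zero; suc; _+_; _*_; _∸_; _≤_; z≤n)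
  open import Data.Nat.Properties hiding (_≟_)
  open import Data.Nat.Tactic.RingSolver using (solve-∀)
  open import Data.Nat.ListAction using () renaming (sum to sumₗ)
  open import Data.Bool using (Bool; true; false; not; _∧_; if_then_else_)
  open import Data.Fin using (Fin; zero; suc)
  open import Data.Fin.Properties using (_≟_; any?)
  open import Data.List using (tabulate)
  open import Data.List.Properties using (map-tabulate)
  open import Data.Product using (_,_; proj₁; proj₂)
  open import Data.Sum using ([_,_]′)
  open import Function using (_∘_; id)
  open import Function.Definitions using (Injective)
  open import Relation.Nullary using (Dec; yes; no; does; contradiction)
  open import Relation.Nullary.Decidable using (dec-false)
  open import Relation.Binary.PropositionalEquality
  open import Algebra.Properties.Semiring.Sum +-*-semiring
    using (sum; sum-syntax; sum-cong-≗; sum-replicate-zero; ∑-distrib-+; ∑-comm; *-distribˡ-sum; *-distribʳ-sum)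

  open ≤-Reasoning

  𝟙 : Bool → ℕ
  𝟙 b = if b then 1 else 0

  𝟙-does-mono : ∀ {A B : Set} (a? : Dec A) (b? : Dec B) → (A → B) → 𝟙 (does a?) ≤ 𝟙 (does b?)
  𝟙-does-mono (no _)  _        _   = z≤n
  𝟙-does-mono (yes _) (yes _)  _   = ≤-refl
  𝟙-does-mono (yes a) (no ¬b)  a→b = contradiction (a→b a) ¬b

  𝟙-not+𝟙 : ∀ b → 𝟙 (not b) + 𝟙 b ≡ 1
  𝟙-not+𝟙 true  = refl
  𝟙-not+𝟙 false = refl

  𝟙*𝟙 : ∀ b → 𝟙 b * 𝟙 b ≡ 𝟙 b
  𝟙*𝟙 true  = refl
  𝟙*𝟙 false = refl

  count : ∀ {n} → (Fin n → Bool) → ℕ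
  count {n} p = ∑[ i < n ] 𝟙 (p i)

  ∑-mono-≤ : ∀ {n} {f g : Fin n → ℕ} → (∀ i → f i ≤ g i) → sum f ≤ sum g
  ∑-mono-≤ {zero}  _   = z≤n
  ∑-mono-≤ {suc n} f≤g = +-mono-≤ (f≤g zero) (∑-mono-≤ (f≤g ∘ suc))

  ∑-const : ∀ n k → ∑[ i < n ] k ≡ n * k
  ∑-const zero    k = refl
  ∑-const (suc n) k = cong (k +_) (∑-const n k)

  ∑*∑ : ∀ {m n} (f : Fin m → ℕ) (g : Fin n → ℕ) → sum f * sum g ≡ ∑[ i < m ] ∑[ j < n ] (f i * g j)
  ∑*∑ f g = trans (*-distribʳ-sum (sum g) f) (sum-cong-≗ (λ i → *-distribˡ-sum (f i) g))

  sumₗ-tabulate : ∀ {n} (f : Fin n → ℕ) → sumₗ (tabulate f) ≡ sum f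
  sumₗ-tabulate {zero}  f = refl
  sumₗ-tabulate {suc n} f = cong (f zero +_) (sumₗ-tabulate (f ∘ suc))

  ∑-𝟙-≟ : ∀ {n} (x : Fin n) → ∑[ j < n ] 𝟙 (does (x ≟ j)) ≡ 1
  ∑-𝟙-≟ {suc n} zero    = cong suc (sum-replicate-zero n)
  ∑-𝟙-≟ {suc n} (suc x) = ∑-𝟙-≟ x

  ∑-𝟙-≟*𝟙-≟ : ∀ {n} (x y : Fin n) → ∑[ j < n ] (𝟙 (does (x ≟ j)) * 𝟙 (does (y ≟ j))) ≡ 𝟙 (does (x ≟ y))
  ∑-𝟙-≟*𝟙-≟ {n} x y with x ≟ y
  ... | yes refl = trans (sum-cong-≗ (λ j → 𝟙*𝟙 (does (x ≟ j)))) (∑-𝟙-≟ x)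
  ... | no x≢y   = trans (sum-cong-≗ disjoint) (sum-replicate-zero n)
    where
    disjoint : ∀ j → 𝟙 (does (x ≟ j)) * 𝟙 (does (y ≟ j)) ≡ 0
    disjoint j with x ≟ j | y ≟ j
    ... | yes refl | yes refl = contradiction refl x≢y
    ... | yes _    | no _     = refl
    ... | no _     | _        = refl

  fibre-≤ : ∀ {t n} {f : Fin t → Fin n} → Injective _≡_ _≡_ f →
            (p : Fin n → Bool) → (∀ i → p (f i) ≡ true) →
            ∀ w → ∑[ i < t ] 𝟙 (does (f i ≟ w)) ≤ 𝟙 (p w)
  fibre-≤ {t} {f = f} inj p pf w with any? (λ i → f i ≟ w)
  ... | yes (i₀ , refl) rewrite pf i₀ = begin
    ∑[ i < t ] 𝟙 (does (f i ≟ f i₀))  ≤⟨ ∑-mono-≤ (λ i → 𝟙-does-mono (f i ≟ f i₀) (i₀ ≟ i) (sym ∘ inj)) ⟩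
    ∑[ i < t ] 𝟙 (does (i₀ ≟ i))      ≡⟨ ∑-𝟙-≟ i₀ ⟩
    1                                  ∎
  ... | no ∄i = begin
    ∑[ i < t ] 𝟙 (does (f i ≟ w))  ≡⟨ sum-cong-≗ (λ i → cong 𝟙 (dec-false (f i ≟ w) (λ fi≡w → ∄i (i , fi≡w)))) ⟩
    ∑[ i < t ] 0                    ≡⟨ sum-replicate-zero t ⟩
    0                               ≤⟨ z≤n ⟩
    𝟙 (p w)                         ∎

  injective⇒≤-count : ∀ {t n} {f : Fin t → Fin n} → Injective _≡_ _≡_ f →
                      (p : Fin n → Bool) → (∀ i → p (f i) ≡ true) → t ≤ count p
  injective⇒≤-count {t} {n} {f} inj p pf = begin
    t                                              ≡⟨ trans (∑-const t 1) (*-identityʳ t) ⟨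
    ∑[ i < t ] 1                                   ≡⟨ sum-cong-≗ (λ i → ∑-𝟙-≟ (f i)) ⟨
    ∑[ i < t ] ∑[ w < n ] 𝟙 (does (f i ≟ w))       ≡⟨ ∑-comm (λ i w → 𝟙 (does (f i ≟ w))) ⟩
    ∑[ w < n ] ∑[ i < t ] 𝟙 (does (f i ≟ w))       ≤⟨ ∑-mono-≤ (fibre-≤ inj p pf) ⟩
    count p                                        ∎

  2*m*n≤m*m+n*n : ∀ m n → 2 * (m * n) ≤ m * m + n * n
  2*m*n≤m*m+n*n m n = [ ordered , swapped ]′ (≤-total m n)
    where
    ordered : ∀ {m n} → m ≤ n → 2 * (m * n) ≤ m * m + n * n
    ordered {m} m≤n with k , refl ← m≤n⇒∃[o]m+o≡n m≤n =
      ≤-trans (m≤m+n _ (k * k)) (≤-reflexive (square-gap m k))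
      where
      square-gap : ∀ m k → 2 * (m * (m + k)) + k * k ≡ m * m + (m + k) * (m + k)
      square-gap = solve-∀
    swapped : n ≤ m → 2 * (m * n) ≤ m * m + n * n
    swapped n≤m = subst₂ _≤_ (cong (2 *_) (*-comm n m)) (+-comm (n * n) (m * m)) (ordered n≤m)

  cauchy-schwarz : ∀ {n} (f : Fin n → ℕ) → sum f * sum f ≤ n * ∑[ i < n ] (f i * f i)
  cauchy-schwarz {n} f = *-cancelˡ-≤ 2 (begin
    2 * (sum f * sum f)                            ≡⟨ cong (2 *_) (∑*∑ f f) ⟩
    2 * ∑[ i < n ] ∑[ j < n ] (f i * f j)          ≡⟨ *-distribˡ-sum 2 (λ i → ∑[ j < n ] (f i * f j)) ⟩
    ∑[ i < n ] (2 * ∑[ j < n ] (f i * f j))        ≡⟨ sum-cong-≗ (λ i → *-distribˡ-sum 2 (λ j → f i * f j)) ⟩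
    ∑[ i < n ] ∑[ j < n ] (2 * (f i * f j))        ≤⟨ ∑-mono-≤ (λ i → ∑-mono-≤ (λ j → 2*m*n≤m*m+n*n (f i) (f j))) ⟩
    ∑[ i < n ] ∑[ j < n ] (f² i + f² j)            ≡⟨ sum-cong-≗ (λ i → trans (∑-distrib-+ (λ _ → f² i) f²) (cong (_+ Q) (∑-const n (f² i)))) ⟩
    ∑[ i < n ] (n * f² i + Q)                      ≡⟨ ∑-distrib-+ (λ i → n * f² i) (λ _ → Q) ⟩
    ∑[ i < n ] (n * f² i) + ∑[ i < n ] Q           ≡⟨ cong₂ _+_ (sym (*-distribˡ-sum n f²)) (∑-const n Q) ⟩
    n * Q + n * Q                                  ≡⟨ cong (n * Q +_) (+-identityʳ (n * Q)) ⟨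
    2 * (n * Q)                                    ∎)
    where
    f² : Fin n → ℕ
    f² i = f i * f i
    Q : ℕ
    Q = sum f²

  module ColourClasses {n r} (X : Fin n → ℕ) (K : Fin n → Fin r) where

    class-size : Fin r → ℕ
    class-size j = ∑[ u < n ] (X u * 𝟙 (does (K u ≟ j)))

    same-colour : Fin n → Fin n → Bool
    same-colour u v = does (K u ≟ K v)

    monochromatic bichromatic : ℕ
    monochromatic = ∑[ u < n ] ∑[ v < n ] (X u * X v * 𝟙 (same-colour u v))
    bichromatic   = ∑[ u < n ] ∑[ v < n ] (X u * X v * 𝟙 (not (same-colour u v)))

    bichromatic+monochromatic : bichromatic + monochromatic ≡ sum X * sum X
    bichromatic+monochromatic = begin-equality
      bichromatic + monochromatic
        ≡⟨ ∑-distrib-+ (λ u → ∑[ v < n ] (bi u v)) (λ u → ∑[ v < n ] (mono u v)) ⟨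
      ∑[ u < n ] (∑[ v < n ] (bi u v) + ∑[ v < n ] (mono u v))
        ≡⟨ sum-cong-≗ (λ u → trans (sum-cong-≗ (λ v → split (X u * X v) (same-colour u v))) (∑-distrib-+ (bi u) (mono u))) ⟨
      ∑[ u < n ] ∑[ v < n ] (X u * X v)
        ≡⟨ ∑*∑ X X ⟨
      sum X * sum X ∎
      where
      bi mono : Fin n → Fin n → ℕ
      bi   u v = X u * X v * 𝟙 (not (same-colour u v))
      mono u v = X u * X v * 𝟙 (same-colour u v)
      split : ∀ a b → a ≡ a * 𝟙 (not b) + a * 𝟙 b
      split a b = begin-equality
        a                          ≡⟨ *-identityʳ a ⟨
        a * 1                      ≡⟨ cong (a *_) (𝟙-not+𝟙 b) ⟨
        a * (𝟙 (not b) + 𝟙 b)      ≡⟨ *-distribˡ-+ a (𝟙 (not b)) (𝟙 b) ⟩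
        a * 𝟙 (not b) + a * 𝟙 b    ∎

    monochromatic≡∑class-size² : monochromatic ≡ ∑[ j < r ] (class-size j * class-size j)
    monochromatic≡∑class-size² = begin-equality
      monochromatic
        ≡⟨ sum-cong-≗ (λ u → sum-cong-≗ (λ v → by-colour u v)) ⟩
      ∑[ u < n ] ∑[ v < n ] ∑[ j < r ] (Y u j * Y v j)
        ≡⟨ sum-cong-≗ (λ u → ∑-comm (λ v j → Y u j * Y v j)) ⟩
      ∑[ u < n ] ∑[ j < r ] ∑[ v < n ] (Y u j * Y v j)
        ≡⟨ ∑-comm (λ u j → ∑[ v < n ] (Y u j * Y v j)) ⟩
      ∑[ j < r ] ∑[ u < n ] ∑[ v < n ] (Y u j * Y v j)
        ≡⟨ sum-cong-≗ (λ j → ∑*∑ (λ u → Y u j) (λ v → Y v j)) ⟨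
      ∑[ j < r ] (class-size j * class-size j) ∎
      where
      Y : Fin n → Fin r → ℕ
      Y u j = X u * 𝟙 (does (K u ≟ j))
      by-colour : ∀ u v → X u * X v * 𝟙 (same-colour u v) ≡ ∑[ j < r ] (Y u j * Y v j)
      by-colour u v = begin-equality
        X u * X v * 𝟙 (same-colour u v)
          ≡⟨ cong (X u * X v *_) (∑-𝟙-≟*𝟙-≟ (K u) (K v)) ⟨
        X u * X v * ∑[ j < r ] (𝟙 (does (K u ≟ j)) * 𝟙 (does (K v ≟ j)))
          ≡⟨ *-distribˡ-sum (X u * X v) (λ j → 𝟙 (does (K u ≟ j)) * 𝟙 (does (K v ≟ j))) ⟩
        ∑[ j < r ] (X u * X v * (𝟙 (does (K u ≟ j)) * 𝟙 (does (K v ≟ j))))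
          ≡⟨ sum-cong-≗ (λ j → [m*n]*[o*p]≡[m*o]*[n*p] (X u) (X v) (𝟙 (does (K u ≟ j))) (𝟙 (does (K v ≟ j)))) ⟩
        ∑[ j < r ] (Y u j * Y v j) ∎

    ∑class-size≡∑X : ∑[ j < r ] class-size j ≡ sum X
    ∑class-size≡∑X = begin-equality
      ∑[ j < r ] ∑[ u < n ] (X u * 𝟙 (does (K u ≟ j)))  ≡⟨ ∑-comm (λ j u → X u * 𝟙 (does (K u ≟ j))) ⟩
      ∑[ u < n ] ∑[ j < r ] (X u * 𝟙 (does (K u ≟ j)))  ≡⟨ sum-cong-≗ (λ u → sym (*-distribˡ-sum (X u) (λ j → 𝟙 (does (K u ≟ j))))) ⟩
      ∑[ u < n ] (X u * ∑[ j < r ] 𝟙 (does (K u ≟ j)))  ≡⟨ sum-cong-≗ (λ u → trans (cong (X u *_) (∑-𝟙-≟ (K u))) (*-identityʳ (X u))) ⟩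
      sum X                                            ∎

    r*bichromatic+[∑X]²≤r*[∑X]² : r * bichromatic + sum X * sum X ≤ r * (sum X * sum X)
    r*bichromatic+[∑X]²≤r*[∑X]² = begin
      r * bichromatic + sum X * sum X
        ≡⟨ cong (λ s → r * bichromatic + s * s) ∑class-size≡∑X ⟨
      r * bichromatic + sum class-size * sum class-size
        ≤⟨ +-monoʳ-≤ (r * bichromatic) (cauchy-schwarz class-size) ⟩
      r * bichromatic + r * ∑[ j < r ] (class-size j * class-size j)
        ≡⟨ cong (λ s → r * bichromatic + r * s) monochromatic≡∑class-size² ⟨
      r * bichromatic + r * monochromatic
        ≡⟨ *-distribˡ-+ r bichromatic monochromatic ⟨
      r * (bichromatic + monochromatic)
        ≡⟨ cong (r *_) bichromatic+monochromatic ⟩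
      r * (sum X * sum X) ∎

  count-≢ : ∀ {n} (u : Fin n) → count (λ v → not (does (u ≟ v))) ≡ n ∸ 1
  count-≢ {n} u = begin-equality
    count (λ v → not (does (u ≟ v)))              ≡⟨ m+n∸n≡m _ 1 ⟨
    count (λ v → not (does (u ≟ v))) + 1 ∸ 1      ≡⟨ cong (λ k → count (λ v → not (does (u ≟ v))) + k ∸ 1) (∑-𝟙-≟ u) ⟨
    count (λ v → not (does (u ≟ v))) + count (λ v → does (u ≟ v)) ∸ 1
      ≡⟨ cong (_∸ 1) (∑-distrib-+ (λ v → 𝟙 (not (does (u ≟ v)))) (λ v → 𝟙 (does (u ≟ v)))) ⟨
    ∑[ v < n ] (𝟙 (not (does (u ≟ v))) + 𝟙 (does (u ≟ v))) ∸ 1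
      ≡⟨ cong (_∸ 1) (trans (sum-cong-≗ (λ v → 𝟙-not+𝟙 (does (u ≟ v)))) (trans (∑-const n 1) (*-identityʳ n))) ⟩
    n ∸ 1                                          ∎

  deg≡count : ∀ {n} (G : Graph n) v → deg G v ≡ count (adj G v)
  deg≡count G v = trans (cong sumₗ (map-tabulate id (λ w → 𝟙 (adj G v w)))) (sumₗ-tabulate (λ w → 𝟙 (adj G v w)))

  ∑deg² : ∀ {n} → Graph n → ℕ
  ∑deg² {n} G = ∑[ w < n ] (deg G w * deg G w)

  module AlternatingPaths {n r} (G : Graph n) (col : EdgeColouring G r) where

    c : Fin n → Fin n → Fin r
    c = proj₁ col

    alternating : Fin n → Fin n → Fin n → Bool
    alternating u w v = adj G u w ∧ adj G w v ∧ not (does (c u w ≟ c w v))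

    alternating-true : ∀ {u w v} → AltPath2 G col u w v → alternating u w v ≡ true
    alternating-true {u} {w} {v} (uw , wv , c≢) rewrite uw | wv = cong not (dec-false (c u w ≟ c w v) c≢)

    paths⇒≤count : ∀ {u v t} → DisjAltPaths2 G col u v t → t ≤ count (λ w → alternating u w v)
    paths⇒≤count (mid , inj , alt) = injective⇒≤-count inj _ (λ i → alternating-true (alt i))

    -- Reading both edges at w (symmetry of adj and of the colouring), alternation through w
    -- only compares the colours of uw and vw.
    𝟙-alternating : ∀ u w v → 𝟙 (alternating u w v) ≡ 𝟙 (adj G u w) * 𝟙 (adj G v w) * 𝟙 (not (does (c u w ≟ c v w)))
    𝟙-alternating u w v rewrite adj-sym G w v with adj G u w | adj G v w in vw
    ... | false | _     = refl
    ... | true  | false = refl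
    ... | true  | true  rewrite proj₂ col w v (trans (adj-sym G w v) vw) = sym (+-identityʳ _)

    r*∑∑alternating+deg²≤r*deg² : ∀ w →
      r * ∑[ u < n ] ∑[ v < n ] 𝟙 (alternating u w v) + deg G w * deg G w ≤ r * (deg G w * deg G w)
    r*∑∑alternating+deg²≤r*deg² w = begin
      r * ∑[ u < n ] ∑[ v < n ] 𝟙 (alternating u w v) + deg G w * deg G w
        ≡⟨ cong₂ (λ a d → r * a + d * d) (sum-cong-≗ (λ u → sum-cong-≗ (𝟙-alternating u w))) deg≡∑X ⟩
      r * bichromatic + sum X * sum X
        ≤⟨ r*bichromatic+[∑X]²≤r*[∑X]² ⟩
      r * (sum X * sum X)
        ≡⟨ cong (λ d → r * (d * d)) deg≡∑X ⟨
      r * (deg G w * deg G w) ∎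
      where
      X : Fin n → ℕ
      X u = 𝟙 (adj G u w)
      open ColourClasses X (λ u → c u w)
      deg≡∑X : deg G w ≡ sum X
      deg≡∑X = trans (deg≡count G w) (sum-cong-≗ (λ u → cong 𝟙 (adj-sym G w u)))

    module _ {t} (paths : ∀ u v → u ≢ v → DisjAltPaths2 G col u v t) where

      t*𝟙[u≢v]≤count : ∀ u v → t * 𝟙 (not (does (u ≟ v))) ≤ count (λ w → alternating u w v)
      t*𝟙[u≢v]≤count u v with u ≟ v
      ... | yes _   = ≤-trans (≤-reflexive (*-zeroʳ t)) z≤n
      ... | no u≢v = ≤-trans (≤-reflexive (*-identityʳ t)) (paths⇒≤count (paths u v u≢v))

      r*n*t*[n-1]+∑deg²≤r*∑deg² : r * (n * (t * (n ∸ 1))) + ∑deg² G ≤ r * ∑deg² G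
      r*n*t*[n-1]+∑deg²≤r*∑deg² = begin
        r * (n * (t * (n ∸ 1))) + ∑deg² G
          ≡⟨ cong (λ a → r * a + ∑deg² G) ordered-pairs ⟩
        r * ∑[ u < n ] ∑[ v < n ] (t * 𝟙 (not (does (u ≟ v)))) + ∑deg² G
          ≤⟨ +-monoˡ-≤ (∑deg² G) (*-monoʳ-≤ r (∑-mono-≤ (λ u → ∑-mono-≤ (t*𝟙[u≢v]≤count u)))) ⟩
        r * ∑[ u < n ] ∑[ v < n ] ∑[ w < n ] A u w v + ∑deg² G
          ≡⟨ cong (λ a → r * a + ∑deg² G) (trans (sum-cong-≗ (λ u → ∑-comm (λ v w → A u w v))) (∑-comm (λ u w → ∑[ v < n ] A u w v))) ⟩
        r * ∑[ w < n ] ∑[ u < n ] ∑[ v < n ] A u w v + ∑deg² G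
          ≡⟨ cong (_+ ∑deg² G) (*-distribˡ-sum r (λ w → ∑[ u < n ] ∑[ v < n ] A u w v)) ⟩
        ∑[ w < n ] (r * ∑[ u < n ] ∑[ v < n ] A u w v) + ∑deg² G
          ≡⟨ ∑-distrib-+ (λ w → r * ∑[ u < n ] ∑[ v < n ] A u w v) deg² ⟨
        ∑[ w < n ] (r * ∑[ u < n ] ∑[ v < n ] A u w v + deg² w)
          ≤⟨ ∑-mono-≤ r*∑∑alternating+deg²≤r*deg² ⟩
        ∑[ w < n ] (r * deg² w)
          ≡⟨ *-distribˡ-sum r deg² ⟨
        r * ∑deg² G ∎
        where
        A : Fin n → Fin n → Fin n → ℕ
        A u w v = 𝟙 (alternating u w v)
        deg² : Fin n → ℕ
        deg² w = deg G w * deg G w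
        ordered-pairs : n * (t * (n ∸ 1)) ≡ ∑[ u < n ] ∑[ v < n ] (t * 𝟙 (not (does (u ≟ v))))
        ordered-pairs = begin-equality
          n * (t * (n ∸ 1))
            ≡⟨ ∑-const n (t * (n ∸ 1)) ⟨
          ∑[ u < n ] (t * (n ∸ 1))
            ≡⟨ sum-cong-≗ {n} (λ u → cong (t *_) (count-≢ u)) ⟨
          ∑[ u < n ] (t * count (λ v → not (does (u ≟ v))))
            ≡⟨ sum-cong-≗ {n} (λ u → *-distribˡ-sum t (λ v → 𝟙 (not (does (u ≟ v))))) ⟩
          ∑[ u < n ] ∑[ v < n ] (t * 𝟙 (not (does (u ≟ v)))) ∎

  achievable⇒[1+r]*n*t*[n-1]≤r*∑deg² : ∀ {n r t} {G : Graph n} → Achievable2 (suc r) G t →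
                                      suc r * (n * (t * (n ∸ 1))) ≤ r * ∑deg² G
  achievable⇒[1+r]*n*t*[n-1]≤r*∑deg² {r = r} {G = G} (col , paths) =
    +-cancelʳ-≤ (∑deg² G) _ _ (≤-trans (r*n*t*[n-1]+∑deg²≤r*∑deg² paths) (≤-reflexive (+-comm (∑deg² G) (r * ∑deg² G))))
    where open AlternatingPaths G col

module Domination where

  open import Data.Nat using (ℕ; zero; suc; _+_; _*_; _≤_; NonZero)
  open import Data.Nat.Properties
    using (≤-trans; ≤-reflexive; m≤m+n; *-monoʳ-≤; +-*-semiring; [m*n]*[o*p]≡[m*o]*[n*p]; module ≤-Reasoning)
  open import Data.Nat.Tactic.RingSolver using (solve-∀; solve)
  open import Data.List using (_∷_; [])
  open import Data.Integer using (+_)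
  import Data.Integer as ℤ
  import Data.Integer.Properties as ℤ
  open import Data.Fin using (Fin; zero; suc)
  open import Data.Rational as ℚ using (ℚ; mkℚ; _/_; 0ℚ)
  import Data.Rational.Properties as ℚ
  import Data.Nat.Coprimality as Coprime
  open import Relation.Binary.PropositionalEquality
  open import Level using (0ℓ)
  open import Relation.Nullary.Decidable using (dec⇒maybe)
  import Tactic.RingSolver as RS
  open import Tactic.RingSolver.Core.AlmostCommutativeRing using (AlmostCommutativeRing; fromCommutativeRing)
  open import Algebra.Properties.Semiring.Sum +-*-semiring using (sum; sum-syntax; sum-cong-≗; *-distribˡ-sum)

  ι : ℕ → ℚ
  ι k = + k / 1

  ι≡mkℚ : ∀ k → ι k ≡ mkℚ (+ k) 0 (Coprime.sym (Coprime.1-coprimeTo k))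
  ι≡mkℚ k = ℚ.normalize-coprime (Coprime.sym (Coprime.1-coprimeTo k))

  ι-homo-+ : ∀ a b → ι (a + b) ≡ ι a ℚ.+ ι b
  ι-homo-+ a b rewrite ι≡mkℚ a | ι≡mkℚ b =
    cong (_/ 1) (sym (cong₂ ℤ._+_ (ℤ.*-identityʳ (+ a)) (ℤ.*-identityʳ (+ b))))

  ι-homo-* : ∀ a b → ι (a * b) ≡ ι a ℚ.* ι b
  ι-homo-* a b rewrite ι≡mkℚ a | ι≡mkℚ b = cong (_/ 1) (ℤ.pos-* a b)

  ι-mono-≤ : ∀ {a b} → a ≤ b → ι a ℚ.≤ ι b
  ι-mono-≤ {a} {b} a≤b rewrite ι≡mkℚ a | ι≡mkℚ b =
    ℚ.*≤* (subst₂ ℤ._≤_ (sym (ℤ.*-identityʳ (+ a))) (sym (ℤ.*-identityʳ (+ b))) (ℤ.+≤+ a≤b))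

  -- With δ = 1/M this reads (1 + δ)² (n + 1)/n ≤ 1 + 1/(k + 1): the room that absorbs the
  -- degree error and the factor n/(n − 1).
  [1+k]*[1+n]*[1+M]²≤[2+k]*n*M² : ∀ k j → let M = 4 * suc k; n = M + j in
                                  suc k * suc n * (suc M * suc M) ≤ suc (suc k) * n * (M * M)
  [1+k]*[1+n]*[1+M]²≤[2+k]*n*M² k j = ≤-trans (m≤m+n _ _) (≤-reflexive (expand k j))
    where
    expand : ∀ k j → (1 + k) * (1 + (4 * (1 + k) + j)) * ((1 + 4 * (1 + k)) * (1 + 4 * (1 + k)))
                     + (3 + 7 * j + 23 * k + 15 * k * j + 36 * k * k + 8 * k * k * j + 16 * k * k * k)
                   ≡ (2 + k) * (4 * (1 + k) + j) * ((4 * (1 + k)) * (4 * (1 + k)))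
    expand = solve-∀

  module Dominated (D : ℚ) where

    -- a ≼ b is a ≤ b·D read in ℚ; it is a record so that unification sees a and b rather
    -- than the normal forms of the rationals + a / 1.
    infix 4 _≼_
    record _≼_ (a b : ℕ) : Set where
      constructor dominated
      field ι≤ι*D : ι a ℚ.≤ ι b ℚ.* D
    open _≼_

    ≤-≼-trans : ∀ {a b c} → a ≤ b → b ≼ c → a ≼ c
    ≤-≼-trans a≤b (dominated b≤c) = dominated (ℚ.≤-trans (ι-mono-≤ a≤b) b≤c)

    ≼-≤-trans : 0ℚ ℚ.≤ D → ∀ {a b c} → a ≼ b → b ≤ c → a ≼ c
    ≼-≤-trans 0≤D (dominated a≤b) b≤c =
      dominated (ℚ.≤-trans a≤b (ℚ.*-monoʳ-≤-nonNeg D {{ℚ.nonNegative 0≤D}} (ι-mono-≤ b≤c)))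

    *-monoˡ-≼ : ∀ c {a b} → a ≼ b → c * a ≼ c * b
    *-monoˡ-≼ c {a} {b} (dominated a≤b) = dominated (begin
      ι (c * a)              ≡⟨ ι-homo-* c a ⟩
      ι c ℚ.* ι a            ≤⟨ ℚ.*-monoˡ-≤-nonNeg (ι c) {{ℚ.normalize-nonNeg c 1}} a≤b ⟩
      ι c ℚ.* (ι b ℚ.* D)    ≡⟨ ℚ.*-assoc (ι c) (ι b) D ⟨
      ι c ℚ.* ι b ℚ.* D      ≡⟨ cong (ℚ._* D) (ι-homo-* c b) ⟨
      ι (c * b) ℚ.* D        ∎)
      where open ℚ.≤-Reasoning

    *-cancelˡ-≼ : ∀ c .{{_ : NonZero c}} {a b} → c * a ≼ c * b → a ≼ b
    *-cancelˡ-≼ c@(suc _) {a} {b} (dominated ca≤cb) = dominated (ℚ.*-cancelˡ-≤-pos (ι c) {{ℚ.normalize-pos c 1}} (begin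
      ι c ℚ.* ι a            ≡⟨ ι-homo-* c a ⟨
      ι (c * a)              ≤⟨ ca≤cb ⟩
      ι (c * b) ℚ.* D        ≡⟨ cong (ℚ._* D) (ι-homo-* c b) ⟩
      ι c ℚ.* ι b ℚ.* D      ≡⟨ ℚ.*-assoc (ι c) (ι b) D ⟩
      ι c ℚ.* (ι b ℚ.* D)    ∎))
      where open ℚ.≤-Reasoning

    ∑-≼ : ∀ {n} {f : Fin n → ℕ} {b} → (∀ i → f i ≼ b) → sum f ≼ n * b
    ∑-≼ {zero}  _ = dominated (ℚ.≤-reflexive (sym (ℚ.*-zeroˡ D)))
    ∑-≼ {suc n} {f} {b} f≼b = dominated (begin
      ι (f zero + sum (λ i → f (suc i)))           ≡⟨ ι-homo-+ (f zero) _ ⟩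
      ι (f zero) ℚ.+ ι (sum (λ i → f (suc i)))     ≤⟨ ℚ.+-mono-≤ (ι≤ι*D (f≼b zero)) (ι≤ι*D (∑-≼ (λ i → f≼b (suc i)))) ⟩
      ι b ℚ.* D ℚ.+ ι (n * b) ℚ.* D                ≡⟨ ℚ.*-distribʳ-+ D (ι b) (ι (n * b)) ⟨
      (ι b ℚ.+ ι (n * b)) ℚ.* D                    ≡⟨ cong (ℚ._* D) (ι-homo-+ b (n * b)) ⟨
      ι (suc n * b) ℚ.* D                          ∎)
      where open ℚ.≤-Reasoning

    k*[1+r]*t*n≼r*[1+k] : 0ℚ ℚ.≤ D → ∀ {r t n n′ k M S} →
      suc r * (n * (t * n′)) ≤ r * S →
      M * M * S ≼ n * (suc M * suc M) →
      k * n * (suc M * suc M) ≤ suc k * n′ * (M * M) →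
      .{{_ : NonZero (n′ * (M * M))}} →
      k * (suc r * (t * n)) ≼ r * suc k
    k*[1+r]*t*n≼r*[1+k] 0≤D {r} {t} {n} {n′} {k} {M} {S} pairs degrees room =
      *-cancelˡ-≼ (n′ * (M * M)) (≤-≼-trans step₁ (≼-≤-trans 0≤D (*-monoˡ-≼ (k * r) degrees) step₂))
      where
      open ≤-Reasoning
      step₁ : n′ * (M * M) * (k * (suc r * (t * n))) ≤ k * r * (M * M * S)
      step₁ = begin
        n′ * (M * M) * (k * (suc r * (t * n)))   ≡⟨ solve (n′ ∷ M ∷ k ∷ r ∷ t ∷ n ∷ []) ⟩
        k * (M * M) * (suc r * (n * (t * n′)))   ≤⟨ *-monoʳ-≤ (k * (M * M)) pairs ⟩
        k * (M * M) * (r * S)                    ≡⟨ solve (k ∷ M ∷ r ∷ S ∷ []) ⟩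
        k * r * (M * M * S)                      ∎
      step₂ : k * r * (n * (suc M * suc M)) ≤ n′ * (M * M) * (r * suc k)
      step₂ = begin
        k * r * (n * (suc M * suc M))        ≡⟨ solve (k ∷ r ∷ n ∷ M ∷ []) ⟩
        r * (k * n * (suc M * suc M))        ≤⟨ *-monoʳ-≤ r room ⟩
        r * (suc k * n′ * (M * M))           ≡⟨ solve (r ∷ k ∷ n′ ∷ M ∷ []) ⟩
        n′ * (M * M) * (r * suc k)           ∎

    ∑-scaled-squares-≼ : ∀ {n} M {x : Fin n → ℕ} {b} → (∀ i → M * x i * (M * x i) ≼ b) →
                         M * M * ∑[ i < n ] (x i * x i) ≼ n * b
    ∑-scaled-squares-≼ {n} M {x} Mx²≼b = ≤-≼-trans (≤-reflexive (begin-equality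
      M * M * ∑[ i < n ] (x i * x i)         ≡⟨ *-distribˡ-sum (M * M) (λ i → x i * x i) ⟩
      ∑[ i < n ] (M * M * (x i * x i))       ≡⟨ sum-cong-≗ (λ i → [m*n]*[o*p]≡[m*o]*[n*p] M M (x i) (x i)) ⟩
      ∑[ i < n ] (M * x i * (M * x i))       ∎)) (∑-≼ Mx²≼b)
      where open ≤-Reasoning

  ℚ-ring : AlmostCommutativeRing 0ℓ 0ℓ
  ℚ-ring = fromCommutativeRing ℚ.+-*-commutativeRing (λ x → dec⇒maybe (0ℚ ℚ.≟ x))

  module _ {d : ℚ} where
    open Dominated (d ℚ.* d)

    square-≼ : ∀ {a c} → ι a ℚ.≤ ι c ℚ.* d → a * a ≼ c * c
    square-≼ {a} {c} a≤cd = dominated (begin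
      ι (a * a)                         ≡⟨ ι-homo-* a a ⟩
      ι a ℚ.* ι a                       ≤⟨ ℚ.*-monoˡ-≤-nonNeg (ι a) {{ℚ.normalize-nonNeg a 1}} a≤cd ⟩
      ι a ℚ.* (ι c ℚ.* d)               ≤⟨ ℚ.*-monoʳ-≤-nonNeg (ι c ℚ.* d) {{ℚ.nonNegative 0≤cd}} a≤cd ⟩
      (ι c ℚ.* d) ℚ.* (ι c ℚ.* d)       ≡⟨ interchange (ι c) d (ι c) d ⟩
      (ι c ℚ.* ι c) ℚ.* (d ℚ.* d)       ≡⟨ cong (ℚ._* (d ℚ.* d)) (ι-homo-* c c) ⟨
      ι (c * c) ℚ.* (d ℚ.* d)           ∎)
      where
      open ℚ.≤-Reasoning
      0≤cd : 0ℚ ℚ.≤ ι c ℚ.* d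
      0≤cd = ℚ.≤-trans (ℚ.nonNegative⁻¹ (ι a) {{ℚ.normalize-nonNeg a 1}}) a≤cd
      interchange : ∀ w x y z → (w ℚ.* x) ℚ.* (y ℚ.* z) ≡ (w ℚ.* y) ℚ.* (x ℚ.* z)
      interchange = RS.solve-∀ ℚ-ring

open import Defs
open import Data.Nat using (ℕ; _≤_; NonZero)
open import Data.Integer using (+_)
open import Data.Rational using (ℚ; _/_; _+_; _-_; _*_; ∣_∣; 0ℚ; 1ℚ; _<_) renaming (_≤_ to _≤ℚ_)
open import Data.Product using (Σ)

import Data.Nat as ℕ
import Data.Nat.Properties as ℕ
import Data.Nat.Coprimality as Coprime
open import Data.Integer as ℤ using (+[1+_]; +0; -[1+_]; +≤+; +<+)
open import Data.Rational using (mkℚ; *≤*; *<*; NonNegative; positive; nonNegative)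
open import Data.Rational.Properties
open import Data.Product using (_,_)
open import Data.Fin using (zero)
open import Relation.Binary.PropositionalEquality
import Tactic.RingSolver as RS

open Counting using (∑deg²; achievable⇒[1+r]*n*t*[n-1]≤r*∑deg²)
open Domination

p≤∣p∣ : ∀ p → p ≤ℚ ∣ p ∣
p≤∣p∣ (mkℚ (+ _)      _ _) = ≤-refl
p≤∣p∣ p@(mkℚ -[1+ _ ] _ _) = ≤-trans (nonPositive⁻¹ p) (0≤∣p∣ p)

ι-*-inverse : ∀ M .{{_ : NonZero M}} → ι M * (+ 1 / M) ≡ 1ℚ
ι-*-inverse (ℕ.suc m) rewrite ι≡mkℚ (ℕ.suc m) | normalize-coprime {1} {m} (Coprime.1-coprimeTo (ℕ.suc m)) =
  *-inverseʳ (mkℚ (+ ℕ.suc m) 0 (Coprime.sym (Coprime.1-coprimeTo (ℕ.suc m))))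

archimedean : ∀ ε → 0ℚ < ε → Σ ℕ λ k → 1ℚ ≤ℚ ι (ℕ.suc k) * ε
archimedean ε@(mkℚ +[1+ a ] k _) _ = k , (begin
  1ℚ                             ≡⟨ ι-*-inverse (ℕ.suc k) ⟨
  ι (ℕ.suc k) * (+ 1 / ℕ.suc k)  ≤⟨ *-monoˡ-≤-nonNeg (ι (ℕ.suc k)) {{normalize-nonNeg (ℕ.suc k) 1}} 1/[1+k]≤ε ⟩
  ι (ℕ.suc k) * ε                ∎)
  where
  open ≤-Reasoning
  1/[1+k]≤ε : + 1 / ℕ.suc k ≤ℚ ε
  1/[1+k]≤ε rewrite normalize-coprime {1} {k} (Coprime.1-coprimeTo (ℕ.suc k)) =
    *≤* (+≤+ (ℕ.s≤s (ℕ.+-monoʳ-≤ k ℕ.z≤n)))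
archimedean (mkℚ +0       _ _) (*<* (+<+ ()))
archimedean (mkℚ -[1+ _ ] _ _) (*<* ())

0≤d : ∀ {x d δ} → 0ℚ < δ → ∣ x - d ∣ ≤ℚ δ * d → 0ℚ ≤ℚ d
0≤d {x} {d} {δ} δ>0 close = *-cancelˡ-≤-pos δ {{positive δ>0}} (begin
  δ * 0ℚ      ≡⟨ *-zeroʳ δ ⟩
  0ℚ          ≤⟨ 0≤∣p∣ (x - d) ⟩
  ∣ x - d ∣   ≤⟨ close ⟩
  δ * d       ∎)
  where open ≤-Reasoning

scaled-degree-bound : ∀ M .{{_ : NonZero M}} {x d} → ∣ ι x - d ∣ ≤ℚ (+ 1 / M) * d →
                      ι (M ℕ.* x) ≤ℚ ι (ℕ.suc M) * d
scaled-degree-bound M {x} {d} close = begin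
  ι (M ℕ.* x)                        ≡⟨ ι-homo-* M x ⟩
  ι M * ι x                          ≤⟨ *-monoˡ-≤-nonNeg (ι M) {{normalize-nonNeg M 1}} x≤d+δd ⟩
  ι M * (d + δ * d)                  ≡⟨ distribute (ι M) d δ ⟩
  ι M * δ * d + ι M * d              ≡⟨ cong (λ z → z * d + ι M * d) (ι-*-inverse M) ⟩
  1ℚ * d + ι M * d                   ≡⟨ *-distribʳ-+ d 1ℚ (ι M) ⟨
  (1ℚ + ι M) * d                     ≡⟨ cong (_* d) (ι-homo-+ 1 M) ⟨
  ι (ℕ.suc M) * d                    ∎
  where
  open ≤-Reasoning
  δ : ℚ
  δ = + 1 / M
  split : ∀ x d → x ≡ d + (x - d)
  split = RS.solve-∀ ℚ-ring
  x≤d+δd : ι x ≤ℚ d + δ * d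
  x≤d+δd = begin
    ι x                    ≡⟨ split (ι x) d ⟩
    d + (ι x - d)          ≤⟨ +-monoʳ-≤ d (≤-trans (p≤∣p∣ (ι x - d)) close) ⟩
    d + δ * d              ∎
  distribute : ∀ m d δ → m * (d + δ * d) ≡ m * δ * d + m * d
  distribute = RS.solve-∀ ℚ-ring

ι[1+r]*[1-1/[1+r]+ε] : ∀ r ε → ι (ℕ.suc r) * (1ℚ - + 1 / ℕ.suc r + ε) ≡ ι r + ι (ℕ.suc r) * ε
ι[1+r]*[1-1/[1+r]+ε] r ε = begin-equality
  ι R * (1ℚ - w + ε)             ≡⟨ distribute (ι R) w ε ⟩
  ι R - ι R * w + ι R * ε        ≡⟨ cong (λ z → ι R - z + ι R * ε) (ι-*-inverse R) ⟩
  ι R - 1ℚ + ι R * ε             ≡⟨ cong (λ z → z - 1ℚ + ι R * ε) (ι-homo-+ 1 r) ⟩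
  1ℚ + ι r - 1ℚ + ι R * ε        ≡⟨ cancel (ι r) (ι R * ε) ⟩
  ι r + ι R * ε                  ∎
  where
  open ≤-Reasoning
  R : ℕ
  R = ℕ.suc r
  w : ℚ
  w = + 1 / R
  distribute : ∀ x w ε → x * (1ℚ - w + ε) ≡ x - x * w + x * ε
  distribute = RS.solve-∀ ℚ-ring
  cancel : ∀ x y → 1ℚ + x - 1ℚ + y ≡ x + y
  cancel = RS.solve-∀ ℚ-ring

≼⇒t*n≤[1-1/r+ε]*D : ∀ {r t n k D ε} .{{_ : NonZero k}} → 0ℚ ≤ℚ D → 1ℚ ≤ℚ ι k * ε →
                     Dominated._≼_ D (k ℕ.* (ℕ.suc r ℕ.* (t ℕ.* n))) (r ℕ.* ℕ.suc k) →
                     ι t * ι n ≤ℚ (1ℚ - + 1 / ℕ.suc r + ε) * D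
≼⇒t*n≤[1-1/r+ε]*D {r} {t} {n} {k@(ℕ.suc _)} {D} {ε} 0≤D 1≤kε (Dominated.dominated bound) =
  *-cancelˡ-≤-pos (ι k * ι R) {{pos*pos⇒pos (ι k) {{normalize-pos k 1}} (ι R) {{normalize-pos R 1}}}} (begin
    ι k * ι R * (ι t * ι n)                 ≡⟨ ι-expand ⟩
    ι (k ℕ.* (R ℕ.* (t ℕ.* n)))            ≤⟨ bound ⟩
    ι (r ℕ.* ℕ.suc k) * D                   ≡⟨ cong (_* D) (trans (ι-homo-* r (ℕ.suc k)) (cong (ι r *_) (ι-homo-+ 1 k))) ⟩
    ι r * (1ℚ + ι k) * D                    ≤⟨ *-monoʳ-≤-nonNeg D {{nonNegative 0≤D}} r≤R*kε ⟩
    (ι r * ι k + ι R * (ι k * ε)) * D       ≡⟨ regroup (ι k) (ι r) (ι R) ε D ⟩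
    ι k * (ι r + ι R * ε) * D               ≡⟨ cong (λ z → ι k * z * D) (ι[1+r]*[1-1/[1+r]+ε] r ε) ⟨
    ι k * (ι R * (1ℚ - + 1 / R + ε)) * D    ≡⟨ reassociate (ι k) (ι R) (1ℚ - + 1 / R + ε) D ⟩
    ι k * ι R * ((1ℚ - + 1 / R + ε) * D)    ∎)
  where
  open ≤-Reasoning
  R : ℕ
  R = ℕ.suc r
  ι-expand : ι k * ι R * (ι t * ι n) ≡ ι (k ℕ.* (R ℕ.* (t ℕ.* n)))
  ι-expand = begin-equality
    ι k * ι R * (ι t * ι n)             ≡⟨ *-assoc (ι k) (ι R) (ι t * ι n) ⟩
    ι k * (ι R * (ι t * ι n))           ≡⟨ cong (λ z → ι k * (ι R * z)) (ι-homo-* t n) ⟨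
    ι k * (ι R * ι (t ℕ.* n))           ≡⟨ cong (ι k *_) (ι-homo-* R (t ℕ.* n)) ⟨
    ι k * ι (R ℕ.* (t ℕ.* n))           ≡⟨ ι-homo-* k (R ℕ.* (t ℕ.* n)) ⟨
    ι (k ℕ.* (R ℕ.* (t ℕ.* n)))         ∎
  expand-r : ∀ r k → r * (1ℚ + k) ≡ r * k + r
  expand-r = RS.solve-∀ ℚ-ring
  r≤R*kε : ι r * (1ℚ + ι k) ≤ℚ ι r * ι k + ι R * (ι k * ε)
  r≤R*kε = begin
    ι r * (1ℚ + ι k)                    ≡⟨ expand-r (ι r) (ι k) ⟩
    ι r * ι k + ι r                     ≤⟨ +-monoʳ-≤ (ι r * ι k) (ι-mono-≤ (ℕ.n≤1+n r)) ⟩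
    ι r * ι k + ι R                     ≡⟨ cong (λ z → ι r * ι k + z) (*-identityʳ (ι R)) ⟨
    ι r * ι k + ι R * 1ℚ                ≤⟨ +-monoʳ-≤ (ι r * ι k) (*-monoˡ-≤-nonNeg (ι R) {{normalize-nonNeg R 1}} 1≤kε) ⟩
    ι r * ι k + ι R * (ι k * ε)         ∎
  regroup : ∀ k r R ε D → (r * k + R * (k * ε)) * D ≡ k * (r + R * ε) * D
  regroup = RS.solve-∀ ℚ-ring
  reassociate : ∀ k R x D → k * (R * x) * D ≡ k * R * (x * D)
  reassociate = RS.solve-∀ ℚ-ring

large-graph-bound : ∀ {r k j t} {d ε : ℚ} → let M = 4 ℕ.* ℕ.suc k; n = ℕ.suc (M ℕ.+ j) in
  (G : Graph n) → 1ℚ ≤ℚ ι (ℕ.suc k) * ε →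
  (∀ v → ∣ ι (deg G v) - d ∣ ≤ℚ (+ 1 / M) * d) →
  Achievable2 (ℕ.suc r) G t →
  ι t * ι n ≤ℚ (1ℚ - + 1 / ℕ.suc r + ε) * (d * d)
large-graph-bound {r} {k} {j} {t} {d} {ε} G 1≤kε close achievable =
  ≼⇒t*n≤[1-1/r+ε]*D {r} {t} {n} {ℕ.suc k} 0≤D 1≤kε
    (k*[1+r]*t*n≼r*[1+k] 0≤D {r} {t} {n} {M ℕ.+ j} {ℕ.suc k} {M} {∑deg² G}
      (achievable⇒[1+r]*n*t*[n-1]≤r*∑deg² {G = G} achievable) degrees ([1+k]*[1+n]*[1+M]²≤[2+k]*n*M² k j))
  where
  M n : ℕ
  M = 4 ℕ.* ℕ.suc k
  n = ℕ.suc (M ℕ.+ j)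
  open Dominated (d * d)
  0≤D : 0ℚ ≤ℚ d * d
  0≤D = nonNegative⁻¹ (d * d) {{nonNeg*nonNeg⇒nonNeg d {{d≥0}} d {{d≥0}}}}
    where
    d≥0 : NonNegative d
    d≥0 = nonNegative (0≤d {ι (deg G zero)} {d} {+ 1 / M} (positive⁻¹ _ {{normalize-pos 1 M}}) (close zero))
  degrees : M ℕ.* M ℕ.* ∑deg² G ≼ n ℕ.* (ℕ.suc M ℕ.* ℕ.suc M)
  degrees = ∑-scaled-squares-≼ M {deg G} (λ w → square-≼ {a = M ℕ.* deg G w} {c = ℕ.suc M} (scaled-degree-bound M {deg G w} (close w)))

lemma3p2 : (G : (n : ℕ) → Graph n) (d : ℕ → ℚ)
    → (∀ ε → 0ℚ < ε → Σ ℕ λ N → ∀ n → N ≤ n → ∀ v →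
         ∣ (+ deg (G n) v / 1) - d n ∣ ≤ℚ ε * d n)
    → (r : ℕ) → .{{_ : NonZero r}} → 2 ≤ r
    → ∀ ε → 0ℚ < ε → Σ ℕ λ N → ∀ n → N ≤ n → ∀ t → Achievable2 r (G n) t
    → (+ t / 1) * (+ n / 1) ≤ℚ (1ℚ - (+ 1 / r) + ε) * (d n * d n)
-- 2 ≤ r only excludes r = 0: the bound holds for every r ≥ 1.
lemma3p2 G d regular 0 ()
lemma3p2 G d regular (ℕ.suc r) _ ε ε>0
  with k , 1≤kε ← archimedean ε ε>0
  with N₀ , close ← regular (+ 1 / (4 ℕ.* ℕ.suc k)) (positive⁻¹ _ {{normalize-pos 1 (4 ℕ.* ℕ.suc k)}})
  = N₀ ℕ.⊔ ℕ.suc (4 ℕ.* ℕ.suc k) , large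
  where
  large : ∀ n → N₀ ℕ.⊔ ℕ.suc (4 ℕ.* ℕ.suc k) ≤ n → ∀ t → Achievable2 (ℕ.suc r) (G n) t →
          ι t * ι n ≤ℚ (1ℚ - + 1 / ℕ.suc r + ε) * (d n * d n)
  large n N≤n t with j , refl ← ℕ.m≤n⇒∃[o]m+o≡n (ℕ.m⊔n≤o⇒n≤o N₀ _ N≤n) =
    large-graph-bound {r} {k} {j} (G _) 1≤kε (close _ (ℕ.m⊔n≤o⇒m≤o N₀ _ N≤n))
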